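{- Let $T$ be a Latin tableau of shape $\lambda$. If the isotopy graph $\mathscr{G}(T)$ is isomorphic to a cube (of some dimension $d$), then $\lambda$ is squareable.
   Context: A partition $\lambda$ has Young diagram with left-justified rows, row $i$ of length $\lambda_i$. A Latin tableau of shape $\lambda$ fills the boxes with positive integers so that row $i$ contains each of $1,\dots,\lambda_i$ exactly once and no integer repeats in a column. Elementary transformations: swapping two rows of equal length, swapping two columns of equal length, or interchanging two entries $x,y$ that occur equally often. Tableaux are isotopic if related by a finite sequence of elementary transformations; $\mathscr{G}(T)$ has as vertices the tableaux isotopic to $T$, two distinct vertices joined by a single edge if one is obtained from the other by one elementary transformation. A graph is a $d$-cube if its vertices can be put in bijection with $\{0,1\}^d$ so that two vertices are adjacent iff their tuples differ in exactly one coordinate. $\lambda$ is squareable if it has no three rows of the same length and no three columns of the same length. -}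

module Defs where

open import Data.Nat using (ℕ; zero; suc; _<_; _≤_; _≡ᵇ_; _<?_)
open import Data.Nat.Properties using (_≟_)
open import Data.Bool using (Bool; true; false; if_then_else_)
open import Data.List using (List; []; _∷_; length; map; filter; upTo)
open import Data.Nat.ListAction using (sum)
open import Data.List.Relation.Unary.All using (All)
open import Data.List.Relation.Binary.Permutation.Propositional using (_↭_)
open import Data.Maybe using (Maybe; just; nothing) renaming (map to mmap)
open import Data.Vec using (Vec)
open import Data.Product using (Σ; ∃; ∃-syntax; _×_; _,_)
open import Data.Sum using (_⊎_)
open import Data.Empty using (⊥)
open import Relation.Nullary using (¬_)
open import Relation.Binary.PropositionalEquality using (_≡_; _≢_)
open import Relation.Binary.Construct.Closure.ReflexiveTransitive using (Star)
open import Function.Definitions using (Injective)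
open import Function.Bundles using (_⇔_)

nth : {A : Set} → List A → ℕ → Maybe A
nth []       _       = nothing
nth (x ∷ xs) zero    = just x
nth (x ∷ xs) (suc i) = nth xs i

swapIdx : ℕ → ℕ → ℕ → ℕ
swapIdx a b k = if k ≡ᵇ a then b else (if k ≡ᵇ b then a else k)

Partition : List ℕ → Set
Partition λ′ = All (0 <_) λ′ ×
  (∀ i x y → nth λ′ i ≡ just x → nth λ′ (suc i) ≡ just y → y ≤ x)

-- A tableau is a list of rows (row i, 0-indexed, is a list of entries)
Tab : Set
Tab = List (List ℕ)

entry : Tab → ℕ → ℕ → Maybe ℕ
entry T i j with nth T i
... | nothing = nothing
... | just r  = nth r j

oneTo : ℕ → List ℕ
oneTo n = map suc (upTo n)

LatinTableau : List ℕ → Tab → Set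
LatinTableau λ′ T =
  map length T ≡ λ′ ×
  (∀ i r n → nth T i ≡ just r → nth λ′ i ≡ just n → r ↭ oneTo n) ×
  (∀ i i′ j x → i ≢ i′ → entry T i j ≡ just x → entry T i′ j ≡ just x → ⊥)

SameShape : Tab → Tab → Set
SameShape T T′ = map length T′ ≡ map length T

colLen : Tab → ℕ → ℕ
colLen T j = length (filter (λ r → j <? length r) T)

occ : ℕ → Tab → ℕ
occ x T = sum (map (λ r → length (filter (x ≟_) r)) T)

RowSwap : Tab → Tab → Set
RowSwap T T′ = ∃[ i ] ∃[ i′ ] (i < length T × i′ < length T ×
  mmap length (nth T i) ≡ mmap length (nth T i′) ×
  length T′ ≡ length T × (∀ k → nth T′ k ≡ nth T (swapIdx i i′ k)))

ColSwap : Tab → Tab → Set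
ColSwap T T′ = ∃[ j ] ∃[ j′ ] (colLen T j ≡ colLen T j′ ×
  SameShape T T′ × (∀ k m → entry T′ k m ≡ entry T k (swapIdx j j′ m)))

SymSwap : Tab → Tab → Set
SymSwap T T′ = ∃[ x ] ∃[ y ] (occ x T ≡ occ y T ×
  SameShape T T′ × (∀ k m → entry T′ k m ≡ mmap (swapIdx x y) (entry T k m)))

Step : Tab → Tab → Set
Step T T′ = RowSwap T T′ ⊎ ColSwap T T′ ⊎ SymSwap T T′

Isotopic : Tab → Tab → Set
Isotopic = Star Step

Adj : Tab → Tab → Set
Adj U V = U ≢ V × Step U V

HammingOne : {d : ℕ} → Vec Bool d → Vec Bool d → Set
HammingOne Vec.[] Vec.[] = ⊥
HammingOne (a Vec.∷ v) (b Vec.∷ w) = (a ≡ b × HammingOne v w) ⊎ (a ≢ b × v ≡ w)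

-- the isotopy graph 𝒢(T) is isomorphic to the d-cube: a bijection from {0,1}^d
-- onto the vertex set {U | U isotopic to T} that preserves and reflects adjacency
IsCube : ℕ → Tab → Set
IsCube d T = Σ (Vec Bool d → Tab) λ f →
  Injective _≡_ _≡_ f ×
  (∀ v → Isotopic T (f v)) ×
  (∀ U → Isotopic T U → ∃[ v ] f v ≡ U) ×
  (∀ v w → Adj (f v) (f w) ⇔ HammingOne v w)

NoThreeEqual : List ℕ → Set
NoThreeEqual xs = ∀ i j k x → i < j → j < k →
  nth xs i ≡ just x → nth xs j ≡ just x → nth xs k ≡ just x → ⊥

conjugate : List ℕ → List ℕ
conjugate [] = []
conjugate (l ∷ ls) = map (λ j → length (filter (λ m → j <? m) (l ∷ ls))) (upTo l)

Squareable : List ℕ → Set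
Squareable λ′ = NoThreeEqual λ′ × NoThreeEqual (conjugate λ′)

module Submission where

-- If three rows (or three columns) of a Latin tableau T have the same length,
-- then 𝒢(T) contains a complete bipartite graph K₂,₃, which no cube contains.
-- Permuting three equal-length lines i, j, k of T (rows, resp. columns) gives
-- tableaux realising permutations of {i, j, k}.  T itself (the identity) and
-- the tableau realising the 3-cycle i ↦ j ↦ k ↦ i are distinct, and each is
-- one elementary transformation away from each of the three tableaux realising
-- (i j), (i k), (j k); but in the d-cube two distinct vertices have at most
-- two common neighbours.

open import Defs
open import Data.Nat using (ℕ; zero; suc; _<_; _≤_; _≡ᵇ_; _<?_; _≤?_; z≤n; s≤s)
open import Data.Nat.Properties
  using (_≟_; ≡ᵇ⇒≡; ≤-trans; ≤-<-trans; <-trans; <⇒≢; ≮⇒≥; ≰⇒>;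
         n≤1+n; 1+n≰n; suc-injective; <-irrefl)
open import Data.Bool using (Bool; true; false) renaming (T to IsTrue)
open import Data.Bool.Properties using () renaming (_≟_ to _≟ᴮ_)
open import Data.Unit using (tt)
open import Data.List using (List; []; _∷_; length; map; filter; applyUpTo; upTo)
open import Data.List.Properties using (length-applyUpTo; filter-accept; filter-reject)
open import Data.List.Relation.Unary.All using (All; _∷_)
open import Data.List.Relation.Unary.AllPairs using (_∷_)
open import Data.List.Relation.Unary.Unique.Propositional using (Unique)
open import Data.List.Relation.Unary.Unique.Propositional.Properties using (map⁺; upTo⁺)
open import Data.List.Relation.Binary.Permutation.Propositional using (↭-sym; ↭⇒↭ₛ)
open import Data.Maybe using (just; nothing; fromMaybe) renaming (map to mmap)
open import Data.Maybe.Properties using (just-injective)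
open import Data.Vec using (Vec; []; _∷_)
open import Data.Product using (Σ; ∃-syntax; _×_; _,_; proj₁; proj₂)
open import Data.Sum using (_⊎_; inj₁; inj₂)
open import Data.Empty using (⊥; ⊥-elim)
open import Relation.Nullary using (¬_; yes; no)
open import Relation.Binary.PropositionalEquality
open import Data.List.Relation.Binary.Permutation.Setoid.Properties (setoid ℕ)
  using (Unique-resp-↭)
open import Relation.Binary.Construct.Closure.ReflexiveTransitive using (ε; _◅_; _◅◅_)
open import Function using (_∘_; id)
open import Function.Bundles using (Equivalence)

≡ᵇ-refl : ∀ a → (a ≡ᵇ a) ≡ true
≡ᵇ-refl zero    = refl
≡ᵇ-refl (suc a) = ≡ᵇ-refl a

≢⇒≡ᵇ-false : ∀ {k a} → k ≢ a → (k ≡ᵇ a) ≡ false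
≢⇒≡ᵇ-false {k} {a} k≢a with k ≡ᵇ a in eq
... | true  = ⊥-elim (k≢a (≡ᵇ⇒≡ k a (subst IsTrue (sym eq) tt)))
... | false = refl

swap-at-left : ∀ a b → swapIdx a b a ≡ b
swap-at-left a b rewrite ≡ᵇ-refl a = refl

swap-at-right : ∀ {a b} → b ≢ a → swapIdx a b b ≡ a
swap-at-right {a} {b} b≢a rewrite ≢⇒≡ᵇ-false b≢a | ≡ᵇ-refl b = refl

swap-elsewhere : ∀ {a b k} → k ≢ a → k ≢ b → swapIdx a b k ≡ k
swap-elsewhere k≢a k≢b rewrite ≢⇒≡ᵇ-false k≢a | ≢⇒≡ᵇ-false k≢b = refl

swap-involutive : ∀ a b k → swapIdx a b (swapIdx a b k) ≡ k
swap-involutive a b k with k ≟ a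
... | yes refl with b ≟ k
...   | yes refl = trans (cong (swapIdx k k) (swap-at-left k k)) (swap-at-left k k)
...   | no b≢k   = trans (cong (swapIdx k b) (swap-at-left k b)) (swap-at-right b≢k)
swap-involutive a b k | no k≢a with k ≟ b
... | yes refl = trans (cong (swapIdx a k) (swap-at-right k≢a)) (swap-at-left a k)
... | no k≢b   = trans (cong (swapIdx a b) (swap-elsewhere k≢a k≢b)) (swap-elsewhere k≢a k≢b)

module _ {i j k : ℕ} (i≢j : i ≢ j) (i≢k : i ≢ k) (j≢k : j ≢ k) where

  private
    j≢i = ≢-sym i≢j
    k≢i = ≢-sym i≢k
    k≢j = ≢-sym j≢k

  swap-ik-via-3-cycle : ∀ m → swapIdx i k m ≡ swapIdx i j (swapIdx j k (swapIdx i j m))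
  swap-ik-via-3-cycle m with m ≟ i
  ... | yes refl rewrite swap-at-left m k | swap-at-left m j | swap-at-left j k
                       | swap-elsewhere k≢i k≢j = refl
  ... | no m≢i with m ≟ j
  ...   | yes refl rewrite swap-elsewhere m≢i j≢k | swap-at-right m≢i
                         | swap-elsewhere i≢j i≢k | swap-at-left i m = refl
  ...   | no m≢j with m ≟ k
  ...     | yes refl rewrite swap-at-right m≢i | swap-elsewhere m≢i m≢j
                           | swap-at-right m≢j | swap-at-right j≢i = refl
  ...     | no m≢k rewrite swap-elsewhere m≢i m≢k | swap-elsewhere m≢i m≢j
                         | swap-elsewhere m≢j m≢k | swap-elsewhere m≢i m≢j = refl

  swap-jk-via-3-cycle : ∀ m → swapIdx j k m ≡ swapIdx i j (swapIdx j k (swapIdx i k m))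
  swap-jk-via-3-cycle m with m ≟ i
  ... | yes refl rewrite swap-elsewhere i≢j i≢k | swap-at-left m k
                       | swap-at-right k≢j | swap-at-right j≢i = refl
  ... | no m≢i with m ≟ j
  ...   | yes refl rewrite swap-at-left m k | swap-elsewhere m≢i j≢k
                         | swap-at-left m k | swap-elsewhere k≢i k≢j = refl
  ...   | no m≢j with m ≟ k
  ...     | yes refl rewrite swap-at-right m≢j | swap-at-right m≢i
                           | swap-elsewhere i≢j i≢k | swap-at-left i j = refl
  ...     | no m≢k rewrite swap-elsewhere m≢j m≢k | swap-elsewhere m≢i m≢k
                         | swap-elsewhere m≢j m≢k | swap-elsewhere m≢i m≢j = refl

pigeonhole-two : ∀ {A : Set} {s t a b c : A} → a ≡ s ⊎ a ≡ t → b ≡ s ⊎ b ≡ t → c ≡ s ⊎ c ≡ t →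
  a ≢ b → a ≢ c → b ≢ c → ⊥
pigeonhole-two (inj₁ a≡s) (inj₁ b≡s) _ a≢b _ _ = a≢b (trans a≡s (sym b≡s))
pigeonhole-two (inj₂ a≡t) (inj₂ b≡t) _ a≢b _ _ = a≢b (trans a≡t (sym b≡t))
pigeonhole-two (inj₁ a≡s) (inj₂ _) (inj₁ c≡s) _ a≢c _ = a≢c (trans a≡s (sym c≡s))
pigeonhole-two (inj₁ _) (inj₂ b≡t) (inj₂ c≡t) _ _ b≢c = b≢c (trans b≡t (sym c≡t))
pigeonhole-two (inj₂ a≡t) (inj₁ _) (inj₂ c≡t) _ a≢c _ = a≢c (trans a≡t (sym c≡t))
pigeonhole-two (inj₂ _) (inj₁ b≡s) (inj₁ c≡s) _ _ b≢c = b≢c (trans b≡s (sym c≡s))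

bool-other : ∀ {x y z : Bool} → x ≢ y → x ≢ z → y ≡ z
bool-other {false} {false} x≢y _ = ⊥-elim (x≢y refl)
bool-other {false} {true} {false} _ x≢z = ⊥-elim (x≢z refl)
bool-other {false} {true} {true} _ _ = refl
bool-other {true} {false} {false} _ _ = refl
bool-other {true} {false} {true} _ x≢z = ⊥-elim (x≢z refl)
bool-other {true} {true} x≢y _ = ⊥-elim (x≢y refl)

CommonNeighbour : ∀ {d} → Vec Bool d → Vec Bool d → Vec Bool d → Set
CommonNeighbour v w a = HammingOne v a × HammingOne w a

common-neighbour-equal-heads : ∀ {d x p} {v w a : Vec Bool d} → v ≢ w →
  CommonNeighbour (x ∷ v) (x ∷ w) (p ∷ a) → x ≡ p × CommonNeighbour v w a
common-neighbour-equal-heads _ (inj₁ (x≡p , va) , inj₁ (_ , wa)) = x≡p , va , wa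
common-neighbour-equal-heads _ (inj₁ (x≡p , _) , inj₂ (x≢p , _)) = ⊥-elim (x≢p x≡p)
common-neighbour-equal-heads _ (inj₂ (x≢p , _) , inj₁ (x≡p , _)) = ⊥-elim (x≢p x≡p)
common-neighbour-equal-heads v≢w (inj₂ (_ , v≡a) , inj₂ (_ , w≡a)) = ⊥-elim (v≢w (trans v≡a (sym w≡a)))

common-neighbour-distinct-heads : ∀ {d x y p} {v w a : Vec Bool d} → x ≢ y →
  CommonNeighbour (x ∷ v) (y ∷ w) (p ∷ a) → p ∷ a ≡ x ∷ w ⊎ p ∷ a ≡ y ∷ v
common-neighbour-distinct-heads x≢y (inj₁ (x≡p , _) , inj₁ (y≡p , _)) = ⊥-elim (x≢y (trans x≡p (sym y≡p)))
common-neighbour-distinct-heads x≢y (inj₁ (refl , _) , inj₂ (_ , refl)) = inj₁ refl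
common-neighbour-distinct-heads x≢y (inj₂ (_ , refl) , inj₁ (refl , _)) = inj₂ refl
common-neighbour-distinct-heads x≢y (inj₂ (x≢p , _) , inj₂ (y≢p , _)) =
  ⊥-elim (y≢p (bool-other x≢y x≢p))

-- Induction on d: if v and w agree in the first coordinate, so do their common
-- neighbours and we pass to the tails; otherwise there are only two candidates.
cube-no-K₂,₃ : ∀ {d} {v w a b c : Vec Bool d} → v ≢ w → a ≢ b → a ≢ c → b ≢ c →
  CommonNeighbour v w a → CommonNeighbour v w b → CommonNeighbour v w c → ⊥
cube-no-K₂,₃ {v = []} {[]} {[]} _ _ _ _ (() , _) _ _
cube-no-K₂,₃ {v = x ∷ v} {y ∷ w} {_ ∷ _} {_ ∷ _} {_ ∷ _} v≢w a≢b a≢c b≢c na nb nc with x ≟ᴮ y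
... | yes refl =
  let (x≡pa , na′) = common-neighbour-equal-heads tails-differ na
      (x≡pb , nb′) = common-neighbour-equal-heads tails-differ nb
      (x≡pc , nc′) = common-neighbour-equal-heads tails-differ nc
  in cube-no-K₂,₃ tails-differ (drop-head x≡pa x≡pb a≢b) (drop-head x≡pa x≡pc a≢c)
       (drop-head x≡pb x≡pc b≢c) na′ nb′ nc′
  where
  tails-differ : v ≢ w
  tails-differ v≡w = v≢w (cong (x ∷_) v≡w)
  drop-head : ∀ {d p q} {s t : Vec Bool d} → x ≡ p → x ≡ q → p ∷ s ≢ q ∷ t → s ≢ t
  drop-head refl refl head-differ s≡t = head-differ (cong (x ∷_) s≡t)
... | no x≢y =
  pigeonhole-two (common-neighbour-distinct-heads x≢y na) (common-neighbour-distinct-heads x≢y nb)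
    (common-neighbour-distinct-heads x≢y nc) a≢b a≢c b≢c

isotopic-along : ∀ {T X Y} → Isotopic T X → Adj X Y → Isotopic T Y
isotopic-along T~X (_ , X→Y) = T~X ◅◅ (X→Y ◅ ε)

isotopy-cube-no-K₂,₃ : ∀ {d T U V A B C} → IsCube d T → Isotopic T U → Isotopic T V → U ≢ V →
  A ≢ B → A ≢ C → B ≢ C → Adj U A → Adj U B → Adj U C → Adj V A → Adj V B → Adj V C → ⊥
isotopy-cube-no-K₂,₃ {U = U} {V} {A} {B} {C} (f , _ , _ , onto , adjacency) T~U T~V U≢V A≢B A≢C B≢C UA UB UC VA VB VC =
  cube-no-K₂,₃ (apart u v U≢V) (apart a b A≢B) (apart a c A≢C) (apart b c B≢C)
    (neighbours u a UA , neighbours v a VA) (neighbours u b UB , neighbours v b VB)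
    (neighbours u c UC , neighbours v c VC)
  where
  Preimage : Tab → Set
  Preimage X = ∃[ x ] f x ≡ X
  u : Preimage U
  u = onto U T~U
  v : Preimage V
  v = onto V T~V
  a : Preimage A
  a = onto A (isotopic-along T~U UA)
  b : Preimage B
  b = onto B (isotopic-along T~U UB)
  c : Preimage C
  c = onto C (isotopic-along T~U UC)
  apart : ∀ {X Y} (x : Preimage X) (y : Preimage Y) → X ≢ Y → proj₁ x ≢ proj₁ y
  apart (_ , refl) (_ , refl) X≢Y refl = X≢Y refl
  neighbours : ∀ {X Y} (x : Preimage X) (y : Preimage Y) → Adj X Y → HammingOne (proj₁ x) (proj₁ y)
  neighbours (x , refl) (y , refl) X~Y = Equivalence.to (adjacency x y) X~Y

data Among (i j k : ℕ) : ℕ → Set where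
  is-i : Among i j k i
  is-j : Among i j k j
  is-k : Among i j k k

-- An interface for permuting three lines i, j, k of T by tableaux: `Realises Y σ`
-- says that Y is T with its lines re-indexed by σ, which exists whenever σ is
-- `Admissible` (e.g. generated by transpositions of the three lines).
record Rearrangements (T : Tab) (i j k : ℕ) : Set₁ where
  field
    Admissible      : (ℕ → ℕ) → Set
    admissible-swap : ∀ {a b} → Among i j k a → Among i j k b → Admissible (swapIdx a b)
    admissible-∘    : ∀ {σ τ} → Admissible σ → Admissible τ → Admissible (σ ∘ τ)
    Realises        : Tab → (ℕ → ℕ) → Set
    realises-id     : Realises T id
    realise         : ∀ {σ} → Admissible σ → Σ Tab λ Y → Realises Y σ
    swap-step : ∀ {Y Z σ τ a b} → Among i j k a → Among i j k b →
      Among i j k (σ a) → Among i j k (σ b) → (∀ m → τ m ≡ σ (swapIdx a b m)) →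
      Realises Y σ → Realises Z τ → Step Y Z
    separated : ∀ {Y Z σ τ} p → Among i j k (σ p) → σ p ≢ τ p →
      Realises Y σ → Realises Z τ → Y ≢ Z

-- Main obstruction: rearranging three lines produces a K₂,₃ in 𝒢(T), with
-- T and the 3-cycle on one side and the three transpositions on the other.
module _ {T : Tab} {i j k : ℕ} (R : Rearrangements T i j k) where

  open Rearrangements R

  rearrangements-obstruct-cube : ∀ {d} → i ≢ j → i ≢ k → j ≢ k → IsCube d T → ⊥
  rearrangements-obstruct-cube i≢j i≢k j≢k cube
    with realise (admissible-swap is-i is-j) | realise (admissible-swap is-i is-k)
       | realise (admissible-swap is-j is-k)
       | realise (admissible-∘ (admissible-swap is-i is-j) (admissible-swap is-j is-k))
  ... | A , rA | B , rB | C , rC | V , rV =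
    isotopy-cube-no-K₂,₃ cube ε (T→A ◅ A→V ◅ ε) T≢V A≢B A≢C B≢C
      (T≢A , T→A) (T≢B , T→B) (T≢C , T→C) (V≢A , V→A) (V≢B , V→B) (V≢C , V→C)
    where
    A-i : swapIdx i j i ≡ j
    A-i = swap-at-left i j
    A-j : swapIdx i j j ≡ i
    A-j = swap-at-right (≢-sym i≢j)
    A-k : swapIdx i j k ≡ k
    A-k = swap-elsewhere (≢-sym i≢k) (≢-sym j≢k)
    B-i : swapIdx i k i ≡ k
    B-i = swap-at-left i k
    C-i : swapIdx j k i ≡ i
    C-i = swap-elsewhere i≢j i≢k
    V-i : swapIdx i j (swapIdx j k i) ≡ j
    V-i = trans (cong (swapIdx i j) C-i) A-i
    V-j : swapIdx i j (swapIdx j k j) ≡ k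
    V-j = trans (cong (swapIdx i j) (swap-at-left j k)) A-k
    V-k : swapIdx i j (swapIdx j k k) ≡ i
    V-k = trans (cong (swapIdx i j) (swap-at-right (≢-sym j≢k))) A-j

    step : ∀ {Y Z σ τ a b a′ b′} → σ a ≡ a′ → σ b ≡ b′ → Among i j k a → Among i j k b →
      Among i j k a′ → Among i j k b′ → (∀ m → τ m ≡ σ (swapIdx a b m)) →
      Realises Y σ → Realises Z τ → Step Y Z
    step refl refl = swap-step

    apart : ∀ {Y Z σ τ} p {q r} → σ p ≡ q → τ p ≡ r → Among i j k q → q ≢ r →
      Realises Y σ → Realises Z τ → Y ≢ Z
    apart p refl refl = separated p

    T→A : Step T A
    T→A = step refl refl is-i is-j is-i is-j (λ _ → refl) realises-id rA
    T→B : Step T B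
    T→B = step refl refl is-i is-k is-i is-k (λ _ → refl) realises-id rB
    T→C : Step T C
    T→C = step refl refl is-j is-k is-j is-k (λ _ → refl) realises-id rC
    A→V : Step A V
    A→V = step A-j A-k is-j is-k is-i is-k (λ _ → refl) rA rV
    V→A : Step V A
    V→A = step V-j V-k is-j is-k is-k is-i
            (λ m → cong (swapIdx i j) (sym (swap-involutive j k m))) rV rA
    V→B : Step V B
    V→B = step V-i V-j is-i is-j is-j is-k (swap-ik-via-3-cycle i≢j i≢k j≢k) rV rB
    V→C : Step V C
    V→C = step V-i V-k is-i is-k is-j is-i (swap-jk-via-3-cycle i≢j i≢k j≢k) rV rC

    T≢A : T ≢ A
    T≢A = apart i refl A-i is-i i≢j realises-id rA
    T≢B : T ≢ B
    T≢B = apart i refl B-i is-i i≢k realises-id rB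
    T≢C : T ≢ C
    T≢C = apart j refl (swap-at-left j k) is-j j≢k realises-id rC
    T≢V : T ≢ V
    T≢V = apart i refl V-i is-i i≢j realises-id rV
    V≢A : V ≢ A
    V≢A = apart j V-j A-j is-k (≢-sym i≢k) rV rA
    V≢B : V ≢ B
    V≢B = apart i V-i B-i is-j j≢k rV rB
    V≢C : V ≢ C
    V≢C = apart i V-i C-i is-j (≢-sym i≢j) rV rC
    A≢B : A ≢ B
    A≢B = apart i A-i B-i is-j j≢k rA rB
    A≢C : A ≢ C
    A≢C = apart i A-i C-i is-j (≢-sym i≢j) rA rC
    B≢C : B ≢ C
    B≢C = apart i B-i C-i is-k (≢-sym i≢k) rB rC

nth-map : ∀ {A B : Set} (f : A → B) xs m → nth (map f xs) m ≡ mmap f (nth xs m)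
nth-map f []       m       = refl
nth-map f (x ∷ xs) zero    = refl
nth-map f (x ∷ xs) (suc m) = nth-map f xs m

nth-just⇒< : ∀ {A : Set} (xs : List A) m {x} → nth xs m ≡ just x → m < length xs
nth-just⇒< (x ∷ xs) zero    _ = s≤s z≤n
nth-just⇒< (x ∷ xs) (suc m) e = s≤s (nth-just⇒< xs m e)

nth-<⇒just : ∀ {A : Set} (xs : List A) m → m < length xs → ∃[ x ] nth xs m ≡ just x
nth-<⇒just (x ∷ xs) zero    _         = x , refl
nth-<⇒just (x ∷ xs) (suc m) (s≤s m<n) = nth-<⇒just xs m m<n

nth-≥⇒nothing : ∀ {A : Set} (xs : List A) m → length xs ≤ m → nth xs m ≡ nothing
nth-≥⇒nothing []       m       _         = refl
nth-≥⇒nothing (x ∷ xs) (suc m) (s≤s n≤m) = nth-≥⇒nothing xs m n≤m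

nth-applyUpTo : ∀ {A : Set} (g : ℕ → A) n m → m < n → nth (applyUpTo g n) m ≡ just (g m)
nth-applyUpTo g (suc n) zero    _         = refl
nth-applyUpTo g (suc n) (suc m) (s≤s m<n) = nth-applyUpTo (g ∘ suc) n m m<n

nth-applyUpTo-just : ∀ {A : Set} (g : ℕ → A) n m {y} → nth (applyUpTo g n) m ≡ just y →
  m < n × g m ≡ y
nth-applyUpTo-just g (suc n) zero    refl = s≤s z≤n , refl
nth-applyUpTo-just g (suc n) (suc m) e    =
  let (m<n , gm≡y) = nth-applyUpTo-just (g ∘ suc) n m e in s≤s m<n , gm≡y

all-nth : ∀ {P : ℕ → Set} {xs} m {z} → All P xs → nth xs m ≡ just z → P z
all-nth {xs = x ∷ xs} zero    (px ∷ _)   refl = px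
all-nth {xs = x ∷ xs} (suc m) (_ ∷ pxs)  e    = all-nth m pxs e

unique-nth : ∀ (xs : List ℕ) {p q z} → Unique xs → nth xs p ≡ just z → nth xs q ≡ just z → p ≡ q
unique-nth (x ∷ xs) {zero}  {zero}  _           _    _    = refl
unique-nth (x ∷ xs) {zero}  {suc q} (x∉ ∷ _)    refl e    = ⊥-elim (all-nth q x∉ e refl)
unique-nth (x ∷ xs) {suc p} {zero}  (x∉ ∷ _)    e    refl = ⊥-elim (all-nth p x∉ e refl)
unique-nth (x ∷ xs) {suc p} {suc q} (_ ∷ uniq)  e    e′   = cong suc (unique-nth xs uniq e e′)

entry-nth : ∀ (T : Tab) {n r} m → nth T n ≡ just r → entry T n m ≡ nth r m
entry-nth T {n} m e with nth T n
entry-nth T m refl | just r = refl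

PreservesRange : ℕ → (ℕ → ℕ) → Set
PreservesRange n σ = ∀ m → (m < n → σ m < n) × (σ m < n → m < n)

swap-preserves-range : ∀ {n a b} → (a < n → b < n) → (b < n → a < n) → PreservesRange n (swapIdx a b)
swap-preserves-range {n} {a} {b} a⇒b b⇒a m with m ≟ a
... | yes refl rewrite swap-at-left m b = a⇒b , b⇒a
... | no m≢a with m ≟ b
...   | yes refl rewrite swap-at-right m≢a = b⇒a , a⇒b
...   | no m≢b rewrite swap-elsewhere m≢a m≢b = id , id

∘-preserves-range : ∀ {n σ τ} → PreservesRange n σ → PreservesRange n τ → PreservesRange n (σ ∘ τ)
∘-preserves-range {σ = σ} {τ} P Q m =
  (λ m<n → proj₁ (P (τ m)) (proj₁ (Q m) m<n)) , (λ στm<n → proj₂ (Q m) (proj₂ (P (τ m)) στm<n))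

reindex : {A : Set} → (ℕ → ℕ) → A → List A → List A
reindex σ d xs = applyUpTo (λ m → fromMaybe d (nth xs (σ m))) (length xs)

length-reindex : ∀ {A : Set} σ (d : A) xs → length (reindex σ d xs) ≡ length xs
length-reindex σ d xs = length-applyUpTo _ (length xs)

nth-reindex : ∀ {A : Set} σ (d : A) xs → PreservesRange (length xs) σ →
  ∀ m → nth (reindex σ d xs) m ≡ nth xs (σ m)
nth-reindex σ d xs P m with m <? length xs
... | yes m<n with nth-<⇒just xs (σ m) (proj₁ (P m) m<n)
...   | x , e rewrite nth-applyUpTo (λ m → fromMaybe d (nth xs (σ m))) (length xs) m m<n | e = refl
nth-reindex σ d xs P m | no m≮n with σ m <? length xs
... | yes σm<n = ⊥-elim (m≮n (proj₂ (P m) σm<n))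
... | no σm≮n = trans (nth-≥⇒nothing (reindex σ d xs) m (subst (_≤ m) (sym (length-reindex σ d xs)) (≮⇒≥ m≮n)))
                      (sym (nth-≥⇒nothing xs (σ m) (≮⇒≥ σm≮n)))

ColumnsLatin : Tab → Set
ColumnsLatin T = ∀ i i′ j x → i ≢ i′ → entry T i j ≡ just x → entry T i′ j ≡ just x → ⊥

map-just⁻ : ∀ {A B : Set} {f : A → B} {mx y} → mmap f mx ≡ just y → ∃[ x ] mx ≡ just x × f x ≡ y
map-just⁻ {mx = just x} refl = x , refl , refl

row-rearrangements : ∀ T {i j k x} → 0 < x →
  (∀ {p} → Among i j k p → mmap length (nth T p) ≡ just x) →
  ColumnsLatin T → Rearrangements T i j k
row-rearrangements T {i} {j} {k} {x} x>0 row-length latin = record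
  { Admissible      = PreservesRange (length T)
  ; admissible-swap = λ ma mb → swap-preserves-range (λ _ → row-exists mb) (λ _ → row-exists ma)
  ; admissible-∘    = ∘-preserves-range
  ; Realises        = λ Y σ → length Y ≡ length T × (∀ m → nth Y m ≡ nth T (σ m))
  ; realises-id     = refl , λ _ → refl
  ; realise         = λ {σ} adm → reindex σ [] T , length-reindex σ [] T , nth-reindex σ [] T adm
  ; swap-step       = λ {Y Z σ τ} → row-swap-step {Y} {Z} {σ} {τ}
  ; separated       = λ p mσp σp≢τp (_ , nY) (_ , nZ) Y≡Z →
      rows-differ mσp σp≢τp (trans (sym (nY p)) (trans (cong (λ Y → nth Y p) Y≡Z) (nZ p)))
  }
  where
  row-exists : ∀ {p} → Among i j k p → p < length T
  row-exists {p} mp = nth-just⇒< T p (proj₁ (proj₂ (map-just⁻ (row-length mp))))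

  -- two of the rows have the same first entry, so they cannot be equal
  rows-differ : ∀ {q r} → Among i j k q → q ≢ r → nth T q ≢ nth T r
  rows-differ {q} {r} mq q≢r same with map-just⁻ {f = length} (row-length mq)
  ... | []    , _   , 0≡x = <-irrefl refl (subst (0 <_) (sym 0≡x) x>0)
  ... | y ∷ _ , row , _   = latin q r 0 y q≢r (entry-nth T 0 row) (entry-nth T 0 (trans (sym same) row))

  -- Y and Z differ by swapping rows a and b, whose lengths agree because they
  -- are rows σ a and σ b of T, both among i, j, k
  row-swap-step : ∀ {Y Z σ τ a b} → Among i j k a → Among i j k b →
    Among i j k (σ a) → Among i j k (σ b) → (∀ m → τ m ≡ σ (swapIdx a b m)) →
    length Y ≡ length T × (∀ m → nth Y m ≡ nth T (σ m)) →
    length Z ≡ length T × (∀ m → nth Z m ≡ nth T (τ m)) → Step Y Z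
  row-swap-step {Y} {Z} {σ} {τ} {a} {b} ma mb mσa mσb τ≡σ∘swap (lY , nY) (lZ , nZ) =
    inj₁ (a , b , subst (a <_) (sym lY) (row-exists ma) , subst (b <_) (sym lY) (row-exists mb) ,
          equal-lengths , trans lZ (sym lY) , λ m → trans (nZ m) (trans (cong (nth T) (τ≡σ∘swap m))
                                                                  (sym (nY (swapIdx a b m)))))
    where
    equal-lengths : mmap length (nth Y a) ≡ mmap length (nth Y b)
    equal-lengths = begin
      mmap length (nth Y a)     ≡⟨ cong (mmap length) (nY a) ⟩
      mmap length (nth T (σ a)) ≡⟨ row-length mσa ⟩
      just x                    ≡⟨ sym (row-length mσb) ⟩
      mmap length (nth T (σ b)) ≡⟨ cong (mmap length) (sym (nY b)) ⟩
      mmap length (nth Y b)     ∎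
      where open ≡-Reasoning

colLen-accept : ∀ (r : List ℕ) T a → a < length r → colLen (r ∷ T) a ≡ suc (colLen T a)
colLen-accept r T a a<r rewrite filter-accept (λ r → a <? length r) {r} {T} a<r = refl

colLen-reject : ∀ (r : List ℕ) T a → ¬ a < length r → colLen (r ∷ T) a ≡ colLen T a
colLen-reject r T a a≮r rewrite filter-reject (λ r → a <? length r) {r} {T} a≮r = refl

-- Column lengths depend only on the shape, which is how `conjugate` computes them.
colLen-via-shape : ∀ a (T : Tab) → colLen T a ≡ length (filter (a <?_) (map length T))
colLen-via-shape a [] = refl
colLen-via-shape a (r ∷ T) with a <? length r
... | yes a<r rewrite colLen-accept r T a a<r
                    | filter-accept (a <?_) {length r} {map length T} a<r = cong suc (colLen-via-shape a T)
... | no a≮r rewrite colLen-reject r T a a≮r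
                    | filter-reject (a <?_) {length r} {map length T} a≮r = colLen-via-shape a T

colLen-shape : ∀ {T Y : Tab} a → SameShape T Y → colLen Y a ≡ colLen T a
colLen-shape {T} {Y} a same rewrite colLen-via-shape a Y | colLen-via-shape a T | same = refl

colLen-antitone : ∀ T {a b} → a ≤ b → colLen T b ≤ colLen T a
colLen-antitone []      _   = z≤n
colLen-antitone (r ∷ T) {a} {b} a≤b with a <? length r | b <? length r
... | yes a<r | yes b<r rewrite colLen-accept r T a a<r | colLen-accept r T b b<r =
  s≤s (colLen-antitone T a≤b)
... | yes a<r | no b≮r rewrite colLen-accept r T a a<r | colLen-reject r T b b≮r =
  ≤-trans (colLen-antitone T a≤b) (n≤1+n _)
... | no a≮r  | yes b<r = ⊥-elim (a≮r (≤-<-trans a≤b b<r))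
... | no a≮r  | no b≮r rewrite colLen-reject r T a a≮r | colLen-reject r T b b≮r =
  colLen-antitone T a≤b

equal-columns-forward : ∀ T {a b n r} → a ≤ b → colLen T a ≡ colLen T b →
  nth T n ≡ just r → a < length r → b < length r
equal-columns-forward (s ∷ T) {a} {b} a≤b same row a<r with a <? length s | b <? length s
equal-columns-forward (s ∷ T) {n = zero} _ _ refl _ | _ | yes b<s = b<s
equal-columns-forward (s ∷ T) {a} {b} {suc n} a≤b same row a<r | yes a<s | yes b<s =
  equal-columns-forward T a≤b (suc-injective (begin
    suc (colLen T a)  ≡⟨ colLen-accept s T a a<s ⟨
    colLen (s ∷ T) a  ≡⟨ same ⟩
    colLen (s ∷ T) b  ≡⟨ colLen-accept s T b b<s ⟩
    suc (colLen T b)  ∎)) row a<r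
  where open ≡-Reasoning
equal-columns-forward (s ∷ T) {a} {b} a≤b same _ _ | yes a<s | no b≮s =
  ⊥-elim (1+n≰n (subst (_≤ colLen T a) column-b-longer (colLen-antitone T a≤b)))
  where
  column-b-longer : colLen T b ≡ suc (colLen T a)
  column-b-longer = begin
    colLen T b        ≡⟨ colLen-reject s T b b≮s ⟨
    colLen (s ∷ T) b  ≡⟨ same ⟨
    colLen (s ∷ T) a  ≡⟨ colLen-accept s T a a<s ⟩
    suc (colLen T a)  ∎
    where open ≡-Reasoning
equal-columns-forward (s ∷ T) a≤b _ _ _ | no a≮s | yes b<s = ⊥-elim (a≮s (≤-<-trans a≤b b<s))
equal-columns-forward (s ∷ T) {n = zero} _ _ refl a<r | no a≮s | no _ = ⊥-elim (a≮s a<r)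
equal-columns-forward (s ∷ T) {a} {b} {suc n} a≤b same row a<r | no a≮s | no b≮s =
  equal-columns-forward T a≤b (trans (sym (colLen-reject s T a a≮s)) (trans same (colLen-reject s T b b≮s)))
    row a<r

equal-columns-same-rows : ∀ T {a b n r} → colLen T a ≡ colLen T b →
  nth T n ≡ just r → a < length r → b < length r
equal-columns-same-rows T {a} {b} same row a<r with a ≤? b
... | yes a≤b = equal-columns-forward T a≤b same row a<r
... | no a≰b  = <-trans (≰⇒> a≰b) a<r

nth-conjugate : ∀ t ts {p x} → nth (conjugate (map length (t ∷ ts))) p ≡ just x →
  p < length t × colLen (t ∷ ts) p ≡ x
nth-conjugate t ts {p} e
  with nth (upTo (length t)) p in at-p | trans (sym (nth-map column-length (upTo (length t)) p)) e
  where
  column-length : ℕ → ℕ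
  column-length j = length (filter (j <?_) (map length (t ∷ ts)))
... | just y | column-length-y with nth-applyUpTo-just id (length t) p at-p
...   | p<t , refl = p<t , trans (colLen-via-shape p (t ∷ ts)) (just-injective column-length-y)

column-rearrangements : ∀ T {t i j k} → nth T 0 ≡ just t → Unique t →
  (∀ {p} → Among i j k p → p < length t) →
  (∀ {p q} → Among i j k p → Among i j k q → colLen T p ≡ colLen T q) →
  Rearrangements T i j k
column-rearrangements T {t} {i} {j} {k} first-row distinct-entries in-first-row equal-columns = record
  { Admissible      = λ σ → ∀ {n r} → nth T n ≡ just r → PreservesRange (length r) σ
  ; admissible-swap = λ ma mb row → swap-preserves-range
      (equal-columns-same-rows T (equal-columns ma mb) row) (equal-columns-same-rows T (equal-columns mb ma) row)
  ; admissible-∘    = λ P Q row → ∘-preserves-range (P row) (Q row)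
  ; Realises        = λ Y σ → SameShape T Y × (∀ n m → entry Y n m ≡ entry T n (σ m))
  ; realises-id     = refl , λ _ _ → refl
  ; realise         = λ {σ} adm → map (reindex σ 0) T , shape-reindex σ T , entry-reindex σ T adm
  ; swap-step       = λ {Y Z σ τ} → column-swap-step {Y} {Z} {σ} {τ}
  ; separated       = λ p mσp σp≢τp (_ , eY) (_ , eZ) Y≡Z →
      columns-differ mσp σp≢τp (trans (sym (eY 0 p)) (trans (cong (λ Y → entry Y 0 p) Y≡Z) (eZ 0 p)))
  }
  where
  shape-reindex : ∀ σ (T : Tab) → SameShape T (map (reindex σ 0) T)
  shape-reindex σ []      = refl
  shape-reindex σ (r ∷ T) = cong₂ _∷_ (length-reindex σ 0 r) (shape-reindex σ T)

  entry-reindex : ∀ σ (T : Tab) → (∀ {n r} → nth T n ≡ just r → PreservesRange (length r) σ) →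
    ∀ n m → entry (map (reindex σ 0) T) n m ≡ entry T n (σ m)
  entry-reindex σ []      P n       m = refl
  entry-reindex σ (r ∷ T) P zero    m = nth-reindex σ 0 r (P {zero} refl) m
  entry-reindex σ (r ∷ T) P (suc n) m = entry-reindex σ T (λ {n} → P {suc n}) n m

  -- the first row has distinct entries, so different columns differ there
  columns-differ : ∀ {q q′} → Among i j k q → q ≢ q′ → entry T 0 q ≢ entry T 0 q′
  columns-differ {q} {q′} mq q≢q′ same with nth-<⇒just t q (in-first-row mq)
  ... | z , at-q = q≢q′ (unique-nth t distinct-entries at-q (begin
    nth t q′       ≡⟨ entry-nth T q′ first-row ⟨
    entry T 0 q′   ≡⟨ same ⟨
    entry T 0 q    ≡⟨ entry-nth T q first-row ⟩
    nth t q        ≡⟨ at-q ⟩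
    just z         ∎))
    where open ≡-Reasoning

  column-swap-step : ∀ {Y Z σ τ a b} → Among i j k a → Among i j k b →
    Among i j k (σ a) → Among i j k (σ b) → (∀ m → τ m ≡ σ (swapIdx a b m)) →
    SameShape T Y × (∀ n m → entry Y n m ≡ entry T n (σ m)) →
    SameShape T Z × (∀ n m → entry Z n m ≡ entry T n (τ m)) → Step Y Z
  column-swap-step {Y} {Z} {σ} {τ} {a} {b} ma mb _ _ τ≡σ∘swap (sY , eY) (sZ , eZ) =
    inj₂ (inj₁ (a , b ,
      trans (colLen-shape a sY) (trans (equal-columns ma mb) (sym (colLen-shape b sY))) ,
      trans sZ (sym sY) ,
      λ n m → trans (eZ n m) (trans (cong (entry T n) (τ≡σ∘swap m)) (sym (eY n (swapIdx a b m))))))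

equal-rows-obstruct-cube : ∀ T → All (0 <_) (map length T) → ColumnsLatin T →
  ∀ {d} → IsCube d T → NoThreeEqual (map length T)
equal-rows-obstruct-cube T positive latin cube i j k x i<j j<k at-i at-j at-k =
  rearrangements-obstruct-cube (row-rearrangements T (all-nth i positive at-i) row-length latin)
    (<⇒≢ i<j) (<⇒≢ (<-trans i<j j<k)) (<⇒≢ j<k) cube
  where
  row-length : ∀ {p} → Among i j k p → mmap length (nth T p) ≡ just x
  row-length is-i = trans (sym (nth-map length T i)) at-i
  row-length is-j = trans (sym (nth-map length T j)) at-j
  row-length is-k = trans (sym (nth-map length T k)) at-k

equal-columns-obstruct-cube : ∀ T → (∀ {r} → nth T 0 ≡ just r → Unique r) →
  ∀ {d} → IsCube d T → NoThreeEqual (conjugate (map length T))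
equal-columns-obstruct-cube []       _           _    _ _ _ _ _ _ () _ _
equal-columns-obstruct-cube (t ∷ ts) first-row-distinct cube i j k x i<j j<k at-i at-j at-k =
  rearrangements-obstruct-cube
    (column-rearrangements (t ∷ ts) refl (first-row-distinct refl) (proj₁ ∘ column) equal-columns)
    (<⇒≢ i<j) (<⇒≢ (<-trans i<j j<k)) (<⇒≢ j<k) cube
  where
  column : ∀ {p} → Among i j k p → p < length t × colLen (t ∷ ts) p ≡ x
  column is-i = nth-conjugate t ts at-i
  column is-j = nth-conjugate t ts at-j
  column is-k = nth-conjugate t ts at-k
  equal-columns : ∀ {p q} → Among i j k p → Among i j k q → colLen (t ∷ ts) p ≡ colLen (t ∷ ts) q
  equal-columns mp mq = trans (proj₂ (column mp)) (sym (proj₂ (column mq)))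

-- Lemma 5.4: if 𝒢(T) is a cube, then the shape λ′ of T is squareable.  The
-- first row of T is a rearrangement of 1, …, λ′₁, so has distinct entries.
lemma5p4 : (λ′ : List ℕ) (T : Tab) → Partition λ′ → LatinTableau λ′ T →
  ∃[ d ] IsCube d T → Squareable λ′
lemma5p4 _ T (positive , _) (refl , rows-rearrange , latin) (_ , cube) =
  equal-rows-obstruct-cube T positive latin cube ,
  equal-columns-obstruct-cube T first-row-distinct cube
  where
  first-row-distinct : ∀ {r} → nth T 0 ≡ just r → Unique r
  first-row-distinct {r} first-row =
    Unique-resp-↭ (↭⇒↭ₛ (↭-sym (rows-rearrange 0 r (length r) first-row
      (trans (nth-map length T 0) (cong (mmap length) first-row)))))
      (map⁺ suc-injective (upTo⁺ (length r)))
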